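{- Let $L$ be a fundamental lattice in which $\lnot\lnot p\wedge\lnot\lnot q\le\lnot\lnot(p\wedge q)$ holds for all $p,q\in L$, and let $a,b\in L$ satisfy $\lnot a=\lnot b$. Then there is $c\in L$ with $c\le a$, $c\le b$, $a\le\lnot\lnot c$ and $b\le\lnot\lnot c$.
   Context: A fundamental lattice is a bounded lattice with a unary operation $\lnot$ that is antitone ($a\le b\Rightarrow\lnot b\le\lnot a$), satisfies $a\wedge\lnot a=0$ and $a\le\lnot\lnot a$. -}

module Defs where

open import Level using (Level; suc; _⊔_)
open import Relation.Binary.Lattice.Bundles using (BoundedLattice)

record FundamentalLattice c ℓ₁ ℓ₂ : Set (suc (c ⊔ ℓ₁ ⊔ ℓ₂)) where
  field
    boundedLattice : BoundedLattice c ℓ₁ ℓ₂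
  open BoundedLattice boundedLattice public
  field
    ¬_          : Carrier → Carrier
    antitone    : ∀ {a b} → a ≤ b → (¬ b) ≤ (¬ a)
    meet-neg    : ∀ a → (a ∧ (¬ a)) ≈ ⊥
    double-neg  : ∀ a → a ≤ (¬ (¬ a))

{-# OPTIONS --safe #-}
module Submission where

open import Defs
open import Data.Product using (Σ; _×_; _,_)

module FundamentalLatticeProperties {c ℓ₁ ℓ₂} (L : FundamentalLattice c ℓ₁ ℓ₂) where
  open FundamentalLattice L

  ¬-≈⇒≤¬¬ : ∀ {a b} → ¬ a ≈ ¬ b → a ≤ ¬ ¬ b
  ¬-≈⇒≤¬¬ {a} ¬a≈¬b = trans (double-neg a) (antitone (reflexive (Eq.sym ¬a≈¬b)))

  ¬¬-SubDistrib-∧ : Set _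
  ¬¬-SubDistrib-∧ = ∀ p q → ¬ ¬ p ∧ ¬ ¬ q ≤ ¬ ¬ (p ∧ q)

  ≤¬¬-∧ : ¬¬-SubDistrib-∧ → ∀ {x p q} → x ≤ ¬ ¬ p → x ≤ ¬ ¬ q → x ≤ ¬ ¬ (p ∧ q)
  ≤¬¬-∧ subdistrib {p = p} {q} x≤¬¬p x≤¬¬q = trans (∧-greatest x≤¬¬p x≤¬¬q) (subdistrib p q)

lemma4p4 : ∀ {c ℓ₁ ℓ₂} (L : FundamentalLattice c ℓ₁ ℓ₂) →
    let open FundamentalLattice L in
    (∀ p q → ((¬ (¬ p)) ∧ (¬ (¬ q))) ≤ (¬ (¬ (p ∧ q)))) →
    ∀ a b → (¬ a) ≈ (¬ b) →
    Σ Carrier (λ c → (c ≤ a) × (c ≤ b) × (a ≤ (¬ (¬ c))) × (b ≤ (¬ (¬ c))))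
lemma4p4 L subdistrib a b ¬a≈¬b =
  a ∧ b , x∧y≤x a b , x∧y≤y a b ,
  ≤¬¬-∧ subdistrib (double-neg a) (¬-≈⇒≤¬¬ ¬a≈¬b) ,
  ≤¬¬-∧ subdistrib (¬-≈⇒≤¬¬ (Eq.sym ¬a≈¬b)) (double-neg b)
  where
  open FundamentalLattice L
  open FundamentalLatticeProperties L
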